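{- Let $\mathcal{D}^1,\mathcal{D}^2,\mathcal{D}^3$ be derivations in $\mathsf{N.IntCK}\cup\{\mathsf{cut}\}$ of $\bullet\varphi,\circ\eta$, of $\bullet\eta,\circ\varphi$, and of $\Gamma\{[\varphi:\Delta]\}$ respectively. Then there is a derivation $\mathcal{D}$ in $\mathsf{N.IntCK}\cup\{\mathsf{cut}\}$ of $\Gamma\{[\eta:\Delta]\}$ such that $rk(\mathcal{D})=\max(rk(\mathcal{D}^1),rk(\mathcal{D}^2),rk(\mathcal{D}^3),w(\varphi)+1)$.
   Context: $\mathcal{L}$: formulas $\varphi ::= p \mid \bot \mid \varphi\wedge\varphi \mid \varphi\vee\varphi \mid \varphi\to\varphi \mid \varphi \mathbin{\Box\!\!\rightarrow} \varphi \mid \varphi \mathbin{\Diamond\!\!\rightarrow}\varphi$. Weight $w(\varphi)$: number of binary connectives (including $\mathbin{\Box\!\!\rightarrow},\mathbin{\Diamond\!\!\rightarrow}$) in $\varphi$. Nested sequents: input formulas $\bullet\varphi$, output formulas $\circ\varphi$. Input sequents $\Lambda ::= \emptyset \mid \Lambda,\bullet\varphi \mid \Lambda,[\psi:\Lambda']$; nested sequents $\Gamma ::= \Lambda,\circ\varphi \mid \Lambda,[\psi:\Gamma']$ ($\psi\in\mathcal{L}$ the index, comma = multiset union). Contexts $\Gamma\{\,\}$: $\{\,\}$ is a context; if $\Delta$ is a sequent and $\Gamma\{\,\}$ a context then $\Delta,\Gamma\{\,\}$ and $[\varphi:\Gamma\{\,\}]$ are contexts; $\Gamma\{\Sigma\}$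 fills the hole (only fillings yielding input/nested sequents allowed); $\Gamma^\downarrow\{\,\}$ deletes the output formula of $\Gamma\{\,\}$, if any. Rules of $\mathsf{N.IntCK}$ (premisses / conclusion): init: $\Gamma\{\bullet p,\circ p\}$; $\bot^\bullet$: $\Gamma\{\bullet\bot\}$; $\wedge^\bullet$: $\Gamma\{\bullet\varphi,\bullet\psi\}$ / $\Gamma\{\bullet(\varphi\wedge\psi)\}$; $\wedge^\circ$: $\Gamma\{\circ\varphi\}$, $\Gamma\{\circ\psi\}$ / $\Gamma\{\circ(\varphi\wedge\psi)\}$; $\vee^\bullet$: $\Gamma\{\bullet\varphi\}$, $\Gamma\{\bullet\psi\}$ / $\Gamma\{\bullet(\varphi\vee\psi)\}$; $\vee^\circ$: $\Gamma\{\circ\varphi\}$ / $\Gamma\{\circ(\varphi\vee\psi)\}$ and $\Gamma\{\circ\psi\}$ / $\Gamma\{\circ(\varphi\vee\psi)\}$; $\to^\bullet$: $\Gamma^\downarrow\{\bullet(\varphi\to\psi),\circ\varphi\}$, $\Gamma\{\bullet\psi\}$ / $\Gamma\{\bullet(\varphi\to\psi)\}$; $\to^\circ$: $\Gamma\{\bullet\varphi,\circ\psi\}$ / $\Gamma\{\circ(\varphi\to\psi)\}$; $\Box^\bullet$: $\bullet\varphi,\circ\eta$; $\bullet\eta,\circ\varphi$; $\Gamma\{\bullet(\varphi\mathbin{\Box\!\!\rightarrow}\psi),[\eta:\bullet\psi,\Delta]\}$ / $\Gamma\{\bullet(\varphi\mathbin{\Box\!\!\rightarrow}\psi),[\eta:\Delta]\}$;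 $\Box^\circ$: $\Gamma\{[\varphi:\circ\psi]\}$ / $\Gamma\{\circ(\varphi\mathbin{\Box\!\!\rightarrow}\psi)\}$; $\Diamond^\bullet$: $\Gamma\{[\varphi:\bullet\psi]\}$ / $\Gamma\{\bullet(\varphi\mathbin{\Diamond\!\!\rightarrow}\psi)\}$; $\Diamond^\circ$: $\bullet\varphi,\circ\eta$; $\bullet\eta,\circ\varphi$; $\Gamma\{[\eta:\circ\psi,\Delta]\}$ / $\Gamma\{\circ(\varphi\mathbin{\Diamond\!\!\rightarrow}\psi),[\eta:\Delta]\}$. cut: $\Gamma^\downarrow\{\circ\xi\}$, $\Gamma\{\bullet\xi\}$ / $\Gamma\{\emptyset\}$ ($\xi$ the cut formula). Derivations: finite trees with leaves instances of init or $\bot^\bullet$. Rank of a cut application: $w(\xi)+1$; $rk(\mathcal{D})$: maximum rank of cut applications in $\mathcal{D}$ ($0$ if none). -}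

module Defs where

open import Data.Nat using (ℕ; zero; suc; _+_; _⊔_)
open import Data.List using (List; []; _∷_; _++_)
open import Relation.Binary.PropositionalEquality using (_≡_)

infixr 30 _∧'_
infixr 25 _∨'_
infixr 20 _⇒_ _□→_ _◇→_

data Fm : Set where
  atom : ℕ → Fm
  ⊥'   : Fm
  _∧'_ _∨'_ _⇒_ _□→_ _◇→_ : Fm → Fm → Fm

w : Fm → ℕ
w (atom _)  = 0
w ⊥'        = 0
w (a ∧' b)  = suc (w a + w b)
w (a ∨' b)  = suc (w a + w b)
w (a ⇒ b)   = suc (w a + w b)
w (a □→ b)  = suc (w a + w b)
w (a ◇→ b)  = suc (w a + w b)

-- Nested sequents, represented as lists of items; comma is list append,
-- and multiset behaviour is recovered by the exchange relation _~_ below.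

data Item : Set where
  ●_   : Fm → Item
  ○_   : Fm → Item
  [_∶_] : Fm → List Item → Item

Seq : Set
Seq = List Item

outs : Seq → ℕ
outs []                = 0
outs (● _ ∷ xs)        = outs xs
outs (○ _ ∷ xs)        = suc (outs xs)
outs ([ _ ∶ S ] ∷ xs)  = outs S + outs xs

delOut : Seq → Seq
delOut []               = []
delOut (● a ∷ xs)       = ● a ∷ delOut xs
delOut (○ _ ∷ xs)       = delOut xs
delOut ([ a ∶ S ] ∷ xs) = [ a ∶ delOut S ] ∷ delOut xs

mutual
  data _≈ᵢ_ : Item → Item → Set where
    ≈● : ∀ {a} → (● a) ≈ᵢ (● a)
    ≈○ : ∀ {a} → (○ a) ≈ᵢ (○ a)
    ≈[] : ∀ {a S T} → S ~ T → [ a ∶ S ] ≈ᵢ [ a ∶ T ]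

  data _~_ : Seq → Seq → Set where
    ~nil   : [] ~ []
    ~cons  : ∀ {x y xs ys} → x ≈ᵢ y → xs ~ ys → (x ∷ xs) ~ (y ∷ ys)
    ~swap  : ∀ {x y xs} → (x ∷ y ∷ xs) ~ (y ∷ x ∷ xs)
    ~trans : ∀ {xs ys zs} → xs ~ ys → ys ~ zs → xs ~ zs

data Ctx : Set where
  hole  : Ctx
  _,,_  : Seq → Ctx → Ctx
  nestC : Fm → Ctx → Ctx

_⟨_⟩ : Ctx → Seq → Seq
hole ⟨ Σ ⟩        = Σ
(Δ ,, C) ⟨ Σ ⟩    = Δ ++ C ⟨ Σ ⟩
nestC a C ⟨ Σ ⟩   = [ a ∶ C ⟨ Σ ⟩ ] ∷ []

_↓ : Ctx → Ctx
hole ↓        = hole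
(Δ ,, C) ↓    = delOut Δ ,, (C ↓)
nestC a C ↓   = nestC a (C ↓)

-- Well-formedness (exactly one output formula, i.e. a nested sequent) is
-- required at the leaves; every rule preserves the number of output
-- formulas from (the last) premiss to conclusion, so all sequents in a
-- derivation are nested sequents.

data Der : Seq → Set where
  init : ∀ (Γ : Ctx) p → outs (Γ ⟨ ● atom p ∷ ○ atom p ∷ [] ⟩) ≡ 1 →
         Der (Γ ⟨ ● atom p ∷ ○ atom p ∷ [] ⟩)
  ⊥● : ∀ (Γ : Ctx) → outs (Γ ⟨ ● ⊥' ∷ [] ⟩) ≡ 1 → Der (Γ ⟨ ● ⊥' ∷ [] ⟩)
  ∧● : ∀ Γ a b → Der (Γ ⟨ ● a ∷ ● b ∷ [] ⟩) → Der (Γ ⟨ ● (a ∧' b) ∷ [] ⟩)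
  ∧○ : ∀ Γ a b → Der (Γ ⟨ ○ a ∷ [] ⟩) → Der (Γ ⟨ ○ b ∷ [] ⟩) →
       Der (Γ ⟨ ○ (a ∧' b) ∷ [] ⟩)
  ∨● : ∀ Γ a b → Der (Γ ⟨ ● a ∷ [] ⟩) → Der (Γ ⟨ ● b ∷ [] ⟩) →
       Der (Γ ⟨ ● (a ∨' b) ∷ [] ⟩)
  ∨○₁ : ∀ Γ a b → Der (Γ ⟨ ○ a ∷ [] ⟩) → Der (Γ ⟨ ○ (a ∨' b) ∷ [] ⟩)
  ∨○₂ : ∀ Γ a b → Der (Γ ⟨ ○ b ∷ [] ⟩) → Der (Γ ⟨ ○ (a ∨' b) ∷ [] ⟩)
  ⇒● : ∀ Γ a b → Der ((Γ ↓) ⟨ ● (a ⇒ b) ∷ ○ a ∷ [] ⟩) → Der (Γ ⟨ ● b ∷ [] ⟩) →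
       Der (Γ ⟨ ● (a ⇒ b) ∷ [] ⟩)
  ⇒○ : ∀ Γ a b → Der (Γ ⟨ ● a ∷ ○ b ∷ [] ⟩) → Der (Γ ⟨ ○ (a ⇒ b) ∷ [] ⟩)
  □● : ∀ Γ a b c (Δ : Seq) → Der (● a ∷ ○ c ∷ []) → Der (● c ∷ ○ a ∷ []) →
       Der (Γ ⟨ ● (a □→ b) ∷ [ c ∶ ● b ∷ Δ ] ∷ [] ⟩) →
       Der (Γ ⟨ ● (a □→ b) ∷ [ c ∶ Δ ] ∷ [] ⟩)
  □○ : ∀ Γ a b → Der (Γ ⟨ [ a ∶ ○ b ∷ [] ] ∷ [] ⟩) → Der (Γ ⟨ ○ (a □→ b) ∷ [] ⟩)
  ◇● : ∀ Γ a b → Der (Γ ⟨ [ a ∶ ● b ∷ [] ] ∷ [] ⟩) → Der (Γ ⟨ ● (a ◇→ b) ∷ [] ⟩)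
  ◇○ : ∀ Γ a b c (Δ : Seq) → Der (● a ∷ ○ c ∷ []) → Der (● c ∷ ○ a ∷ []) →
       Der (Γ ⟨ [ c ∶ ○ b ∷ Δ ] ∷ [] ⟩) →
       Der (Γ ⟨ ○ (a ◇→ b) ∷ [ c ∶ Δ ] ∷ [] ⟩)
  cut : ∀ Γ (ξ : Fm) → Der ((Γ ↓) ⟨ ○ ξ ∷ [] ⟩) → Der (Γ ⟨ ● ξ ∷ [] ⟩) →
        Der (Γ ⟨ [] ⟩)
  -- sequents are multisets: derivations are closed under reordering
  exch : ∀ {S T} → S ~ T → Der S → Der T

rk : ∀ {S} → Der S → ℕ
rk (init _ _ _)         = 0
rk (⊥● _ _)             = 0
rk (∧● _ _ _ d)         = rk d
rk (∧○ _ _ _ d e)       = rk d ⊔ rk e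
rk (∨● _ _ _ d e)       = rk d ⊔ rk e
rk (∨○₁ _ _ _ d)        = rk d
rk (∨○₂ _ _ _ d)        = rk d
rk (⇒● _ _ _ d e)       = rk d ⊔ rk e
rk (⇒○ _ _ _ d)         = rk d
rk (□● _ _ _ _ _ d e f) = rk d ⊔ rk e ⊔ rk f
rk (□○ _ _ _ d)         = rk d
rk (◇● _ _ _ d)         = rk d
rk (◇○ _ _ _ _ _ d e f) = rk d ⊔ rk e ⊔ rk f
rk (cut _ ξ d e)        = suc (w ξ) ⊔ rk d ⊔ rk e
rk (exch _ d)           = rk d

-- Replacing the index φ of one nesting by η is simulated rule by rule.  Only
-- □● and ◇○ look at an index; when it is the replaced φ, their side
-- derivations of ●a,○φ and ●φ,○a become derivations of ●a,○η and ●η,○a by a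
-- cut on φ against D¹ resp. D², which costs rank w(φ)+1.  This bounds the rank
-- by the required maximum.  Equality is then reached by replacing one axiom
-- leaf by a cut on p ∨ ⊥ ∨ … ∨ ⊥ of weight rank − 1, both of whose premisses
-- are cut-free; this lifts the rank of a derivation to any positive value.
module Submission where

open import Defs
open import Data.Nat using (ℕ; zero; suc; pred; _⊔_; _+_; _≤_; z≤n; s≤s; NonZero; >-nonZero)
open import Data.Nat.Properties
open import Data.List using ([]; _∷_; _++_; _∷ʳ_)
open import Data.List.Properties using (++-identityʳ)
open import Data.Product using (Σ; _,_; _×_)
open import Function using (_∘_)
open import Relation.Binary.PropositionalEquality

⊔-bound : ∀ {a b} x y K → a ≤ x ⊔ K → b ≤ y ⊔ K → a ⊔ b ≤ x ⊔ y ⊔ K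
⊔-bound x y K a≤ b≤ = ⊔-lub
  (≤-trans a≤ (⊔-monoˡ-≤ K (m≤m⊔n x y)))
  (≤-trans b≤ (⊔-monoˡ-≤ K (m≤n⊔m x y)))

mutual
  ≈ᵢ-refl : ∀ x → x ≈ᵢ x
  ≈ᵢ-refl (● a)     = ≈●
  ≈ᵢ-refl (○ a)     = ≈○
  ≈ᵢ-refl [ a ∶ S ] = ≈[] (~-refl S)

  ~-refl : ∀ S → S ~ S
  ~-refl []      = ~nil
  ~-refl (x ∷ S) = ~cons (≈ᵢ-refl x) (~-refl S)

++-cong-~ : ∀ Δ {A B} → A ~ B → (Δ ++ A) ~ (Δ ++ B)
++-cong-~ []      A~B = A~B
++-cong-~ (x ∷ Δ) A~B = ~cons (≈ᵢ-refl x) (++-cong-~ Δ A~B)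

fill-cong-~ : ∀ C {A B} → A ~ B → (C ⟨ A ⟩) ~ (C ⟨ B ⟩)
fill-cong-~ hole        A~B = A~B
fill-cong-~ (Δ ,, C)    A~B = ++-cong-~ Δ (fill-cong-~ C A~B)
fill-cong-~ (nestC a C) A~B = ~cons (≈[] (fill-cong-~ C A~B)) ~nil

∷~∷ʳ : ∀ x X → (x ∷ X) ~ (X ∷ʳ x)
∷~∷ʳ x []      = ~-refl (x ∷ [])
∷~∷ʳ x (y ∷ X) = ~trans ~swap (~cons (≈ᵢ-refl y) (∷~∷ʳ x X))

outs-++ : ∀ A B → outs (A ++ B) ≡ outs A + outs B
outs-++ []              B = refl
outs-++ (● _ ∷ A)       B = outs-++ A B
outs-++ (○ _ ∷ A)       B = cong suc (outs-++ A B)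
outs-++ ([ _ ∶ S ] ∷ A) B =
  trans (cong (outs S +_) (outs-++ A B)) (sym (+-assoc (outs S) (outs A) (outs B)))

outs-fill : ∀ C {X Y} → outs X ≡ outs Y → outs (C ⟨ X ⟩) ≡ outs (C ⟨ Y ⟩)
outs-fill hole        eq = eq
outs-fill (Δ ,, C) {X} {Y} eq = begin
  outs (Δ ++ C ⟨ X ⟩)     ≡⟨ outs-++ Δ (C ⟨ X ⟩) ⟩
  outs Δ + outs (C ⟨ X ⟩) ≡⟨ cong (outs Δ +_) (outs-fill C eq) ⟩
  outs Δ + outs (C ⟨ Y ⟩) ≡⟨ outs-++ Δ (C ⟨ Y ⟩) ⟨
  outs (Δ ++ C ⟨ Y ⟩)     ∎
  where open ≡-Reasoning
outs-fill (nestC a C) eq = cong (_+ 0) (outs-fill C eq)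

outs-delOut : ∀ S → outs (delOut S) ≡ 0
outs-delOut []              = refl
outs-delOut (● _ ∷ S)       = outs-delOut S
outs-delOut (○ _ ∷ S)       = outs-delOut S
outs-delOut ([ _ ∶ T ] ∷ S) = cong₂ _+_ (outs-delOut T) (outs-delOut S)

outs-↓ : ∀ C X → outs ((C ↓) ⟨ X ⟩) ≡ outs X
outs-↓ hole        X = refl
outs-↓ (Δ ,, C)    X =
  trans (outs-++ (delOut Δ) ((C ↓) ⟨ X ⟩)) (cong₂ _+_ (outs-delOut Δ) (outs-↓ C X))
outs-↓ (nestC a C) X = trans (+-identityʳ _) (outs-↓ C X)

rk-subst : ∀ {A : Set} (P : A → Seq) {x y} (eq : x ≡ y) (d : Der (P x)) →
           rk (subst (Der ∘ P) eq d) ≡ rk d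
rk-subst P refl d = refl

weaken : ∀ a {S} → Der S → Der (● a ∷ S)
weaken a (init Γ p o)            = init ((● a ∷ []) ,, Γ) p o
weaken a (⊥● Γ o)                = ⊥● ((● a ∷ []) ,, Γ) o
weaken a (∧● Γ x y d)            = ∧● ((● a ∷ []) ,, Γ) x y (weaken a d)
weaken a (∧○ Γ x y d e)          = ∧○ ((● a ∷ []) ,, Γ) x y (weaken a d) (weaken a e)
weaken a (∨● Γ x y d e)          = ∨● ((● a ∷ []) ,, Γ) x y (weaken a d) (weaken a e)
weaken a (∨○₁ Γ x y d)           = ∨○₁ ((● a ∷ []) ,, Γ) x y (weaken a d)
weaken a (∨○₂ Γ x y d)           = ∨○₂ ((● a ∷ []) ,, Γ) x y (weaken a d)
weaken a (⇒● Γ x y d e)          = ⇒● ((● a ∷ []) ,, Γ) x y (weaken a d) (weaken a e)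
weaken a (⇒○ Γ x y d)            = ⇒○ ((● a ∷ []) ,, Γ) x y (weaken a d)
weaken a (□● Γ x y c Δ d e f)    = □● ((● a ∷ []) ,, Γ) x y c Δ d e (weaken a f)
weaken a (□○ Γ x y d)            = □○ ((● a ∷ []) ,, Γ) x y (weaken a d)
weaken a (◇● Γ x y d)            = ◇● ((● a ∷ []) ,, Γ) x y (weaken a d)
weaken a (◇○ Γ x y c Δ d e f)    = ◇○ ((● a ∷ []) ,, Γ) x y c Δ d e (weaken a f)
weaken a (cut Γ ξ d e)           = cut ((● a ∷ []) ,, Γ) ξ (weaken a d) (weaken a e)
weaken a (exch p d)              = exch (~cons ≈● p) (weaken a d)

rk-weaken : ∀ a {S} (d : Der S) → rk (weaken a d) ≡ rk d
rk-weaken a (init Γ p o)         = refl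
rk-weaken a (⊥● Γ o)             = refl
rk-weaken a (∧● Γ x y d)         = rk-weaken a d
rk-weaken a (∧○ Γ x y d e)       = cong₂ _⊔_ (rk-weaken a d) (rk-weaken a e)
rk-weaken a (∨● Γ x y d e)       = cong₂ _⊔_ (rk-weaken a d) (rk-weaken a e)
rk-weaken a (∨○₁ Γ x y d)        = rk-weaken a d
rk-weaken a (∨○₂ Γ x y d)        = rk-weaken a d
rk-weaken a (⇒● Γ x y d e)       = cong₂ _⊔_ (rk-weaken a d) (rk-weaken a e)
rk-weaken a (⇒○ Γ x y d)         = rk-weaken a d
rk-weaken a (□● Γ x y c Δ d e f) = cong (rk d ⊔ rk e ⊔_) (rk-weaken a f)
rk-weaken a (□○ Γ x y d)         = rk-weaken a d
rk-weaken a (◇● Γ x y d)         = rk-weaken a d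
rk-weaken a (◇○ Γ x y c Δ d e f) = cong (rk d ⊔ rk e ⊔_) (rk-weaken a f)
rk-weaken a (cut Γ ξ d e)        = cong₂ (λ u v → suc (w ξ) ⊔ u ⊔ v) (rk-weaken a d) (rk-weaken a e)
rk-weaken a (exch p d)           = rk-weaken a d

cut-trans : ∀ {a b c} (d : Der (● a ∷ ○ b ∷ [])) (e : Der (● b ∷ ○ c ∷ [])) →
            Σ (Der (● a ∷ ○ c ∷ [])) (λ f → rk f ≡ suc (w b) ⊔ rk d ⊔ rk e)
cut-trans {a} {b} {c} d e =
  cut ((● a ∷ ○ c ∷ []) ,, hole) b d (exch (~cons ≈● ~swap) (weaken a e)) ,
  cong (suc (w b) ⊔ rk d ⊔_) (rk-weaken a e)

_⊕_ : Ctx → Seq → Ctx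
hole      ⊕ Y = Y ,, hole
(Δ ,, C)  ⊕ Y = Δ ,, (C ⊕ Y)
nestC a C ⊕ Y = nestC a (C ⊕ Y)

⊕-fill : ∀ C Y X → (C ⊕ Y) ⟨ X ⟩ ≡ C ⟨ Y ++ X ⟩
⊕-fill hole        Y X = refl
⊕-fill (Δ ,, C)    Y X = cong (Δ ++_) (⊕-fill C Y X)
⊕-fill (nestC a C) Y X = cong (λ S → [ a ∶ S ] ∷ []) (⊕-fill C Y X)

⊕-↓ : ∀ C Y → (C ⊕ Y) ↓ ≡ (C ↓) ⊕ delOut Y
⊕-↓ hole        Y = refl
⊕-↓ (Δ ,, C)    Y = cong (delOut Δ ,,_) (⊕-↓ C Y)
⊕-↓ (nestC a C) Y = cong (nestC a) (⊕-↓ C Y)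

outs-⊕● : ∀ C a X → outs ((C ⊕ (● a ∷ [])) ⟨ X ⟩) ≡ outs (C ⟨ X ⟩)
outs-⊕● C a X = trans (cong outs (⊕-fill C (● a ∷ []) X)) (outs-fill C refl)

move-into-hole : ∀ C x Y (d : Der ((C ⊕ (x ∷ [])) ⟨ Y ⟩)) →
                 Σ (Der ((C ⊕ Y) ⟨ x ∷ [] ⟩)) (λ e → rk e ≡ rk d)
move-into-hole C x Y d =
  subst Der (sym (⊕-fill C Y (x ∷ []))) moved ,
  trans (rk-subst (λ S → S) (sym (⊕-fill C Y (x ∷ []))) moved)
        (rk-subst (λ S → S) (⊕-fill C (x ∷ []) Y) d)
  where
  moved : Der (C ⟨ Y ∷ʳ x ⟩)
  moved = exch (fill-cong-~ C (∷~∷ʳ x Y)) (subst Der (⊕-fill C (x ∷ []) Y) d)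

cut-into-hole : ∀ C X ξ (l : Der (((C ↓) ⊕ delOut X) ⟨ ○ ξ ∷ [] ⟩))
                (r : Der ((C ⊕ X) ⟨ ● ξ ∷ [] ⟩)) →
                Σ (Der (C ⟨ X ⟩)) (λ d → rk d ≡ suc (w ξ) ⊔ rk l ⊔ rk r)
cut-into-hole C X ξ l r =
  subst Der filled c ,
  trans (rk-subst (λ S → S) filled c)
        (cong (λ u → suc (w ξ) ⊔ u ⊔ rk r) (rk-subst (_⟨ ○ ξ ∷ [] ⟩) (sym (⊕-↓ C X)) l))
  where
  filled : (C ⊕ X) ⟨ [] ⟩ ≡ C ⟨ X ⟩
  filled = trans (⊕-fill C X []) (cong (C ⟨_⟩) (++-identityʳ X))
  c : Der ((C ⊕ X) ⟨ [] ⟩)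
  c = cut (C ⊕ X) ξ (subst (Der ∘ (_⟨ ○ ξ ∷ [] ⟩)) (sym (⊕-↓ C X)) l) r

_∨⊥^_ : Fm → ℕ → Fm
a ∨⊥^ zero  = a
a ∨⊥^ suc k = (a ∨⊥^ k) ∨' ⊥'

w-∨⊥^ : ∀ a k → w (a ∨⊥^ k) ≡ k + w a
w-∨⊥^ a zero    = refl
w-∨⊥^ a (suc k) = cong suc (trans (+-identityʳ _) (w-∨⊥^ a k))

∨⊥^-intro : ∀ C a k (d : Der (C ⟨ ○ a ∷ [] ⟩)) →
            Σ (Der (C ⟨ ○ (a ∨⊥^ k) ∷ [] ⟩)) (λ e → rk e ≡ rk d)
∨⊥^-intro C a zero    d = d , refl
∨⊥^-intro C a (suc k) d with ∨⊥^-intro C a k d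
... | e , rk-e = ∨○₁ C (a ∨⊥^ k) ⊥' e , rk-e

rank-of-padding : ∀ {a} n .{{_ : NonZero n}} → w a ≡ 0 → ∀ {x y} → x ≡ 0 → y ≡ 0 →
                  suc (w (a ∨⊥^ pred n)) ⊔ x ⊔ y ≡ n
rank-of-padding {a} n wa≡0 refl refl = begin
  suc (w (a ∨⊥^ pred n)) ⊔ 0 ⊔ 0 ≡⟨ trans (⊔-identityʳ _) (⊔-identityʳ _) ⟩
  suc (w (a ∨⊥^ pred n))         ≡⟨ cong suc (trans (w-∨⊥^ a (pred n)) (cong (pred n +_) wa≡0)) ⟩
  suc (pred n + 0)               ≡⟨ cong suc (+-identityʳ (pred n)) ⟩
  suc (pred n)                   ≡⟨ suc-pred n ⟩
  n                              ∎
  where open ≡-Reasoning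

pad-init : ∀ C p (o : outs (C ⟨ ● atom p ∷ ○ atom p ∷ [] ⟩) ≡ 1) n .{{_ : NonZero n}} →
           Σ (Der (C ⟨ ● atom p ∷ ○ atom p ∷ [] ⟩)) (λ d → rk d ≡ n)
pad-init C p o n =
  let (l , rk-l) = ∨⊥^-intro ((C ↓) ⊕ (● atom p ∷ [])) (atom p) (pred n) axiom
      (r , rk-r) = move-into-hole C (● ξ) X
                     (init (C ⊕ (● ξ ∷ [])) p (trans (outs-⊕● C ξ X) o))
      (d , rk-d) = cut-into-hole C X ξ l r
  in d , trans rk-d (rank-of-padding n refl (trans rk-l rk-axiom) rk-r)
  where
  ξ = atom p ∨⊥^ pred n
  X = ● atom p ∷ ○ atom p ∷ []
  axiom : Der (((C ↓) ⊕ (● atom p ∷ [])) ⟨ ○ atom p ∷ [] ⟩)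
  axiom = subst Der (sym (⊕-fill (C ↓) _ _)) (init (C ↓) p (outs-↓ C _))
  rk-axiom : rk axiom ≡ 0
  rk-axiom = rk-subst (λ S → S) (sym (⊕-fill (C ↓) _ _)) (init (C ↓) p (outs-↓ C _))

pad-⊥ : ∀ C (o : outs (C ⟨ ● ⊥' ∷ [] ⟩) ≡ 1) n .{{_ : NonZero n}} →
        Σ (Der (C ⟨ ● ⊥' ∷ [] ⟩)) (λ d → rk d ≡ n)
pad-⊥ C o n =
  let (l , rk-l) = move-into-hole (C ↓) (○ ξ) X
                     (⊥● ((C ↓) ⊕ (○ ξ ∷ [])) (trans (cong outs (⊕-fill (C ↓) _ X)) (outs-↓ C _)))
      (r , rk-r) = move-into-hole C (● ξ) X
                     (⊥● (C ⊕ (● ξ ∷ [])) (trans (outs-⊕● C ξ X) o))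
      (d , rk-d) = cut-into-hole C X ξ l r
  in d , trans rk-d (rank-of-padding n refl rk-l rk-r)
  where
  ξ = ⊥' ∨⊥^ pred n
  X = ● ⊥' ∷ []

⊔-raiseʳ : ∀ x y {z n} → x ⊔ y ≤ n → z ≡ n → x ⊔ z ≡ n
⊔-raiseʳ x y le refl = m≤n⇒m⊔n≡n (m⊔n≤o⇒m≤o x y le)

raise-rank : ∀ {T} (d : Der T) n .{{_ : NonZero n}} → rk d ≤ n → Σ (Der T) (λ e → rk e ≡ n)
raise-rank (init C p o)  n _  = pad-init C p o n
raise-rank (⊥● C o)      n _  = pad-⊥ C o n
raise-rank (∧● C a b d)  n le = let (e , q) = raise-rank d n le in ∧● C a b e , q
raise-rank (∧○ C a b d d') n le =
  let (e , q) = raise-rank d' n (m⊔n≤o⇒n≤o (rk d) _ le) in ∧○ C a b d e , ⊔-raiseʳ (rk d) _ le q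
raise-rank (∨● C a b d d') n le =
  let (e , q) = raise-rank d' n (m⊔n≤o⇒n≤o (rk d) _ le) in ∨● C a b d e , ⊔-raiseʳ (rk d) _ le q
raise-rank (∨○₁ C a b d) n le = let (e , q) = raise-rank d n le in ∨○₁ C a b e , q
raise-rank (∨○₂ C a b d) n le = let (e , q) = raise-rank d n le in ∨○₂ C a b e , q
raise-rank (⇒● C a b d d') n le =
  let (e , q) = raise-rank d' n (m⊔n≤o⇒n≤o (rk d) _ le) in ⇒● C a b d e , ⊔-raiseʳ (rk d) _ le q
raise-rank (⇒○ C a b d)  n le = let (e , q) = raise-rank d n le in ⇒○ C a b e , q
raise-rank (□● C a b c Δ d d' d'') n le =
  let (e , q) = raise-rank d'' n (m⊔n≤o⇒n≤o (rk d ⊔ rk d') _ le) in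
  □● C a b c Δ d d' e , ⊔-raiseʳ (rk d ⊔ rk d') _ le q
raise-rank (□○ C a b d)  n le = let (e , q) = raise-rank d n le in □○ C a b e , q
raise-rank (◇● C a b d)  n le = let (e , q) = raise-rank d n le in ◇● C a b e , q
raise-rank (◇○ C a b c Δ d d' d'') n le =
  let (e , q) = raise-rank d'' n (m⊔n≤o⇒n≤o (rk d ⊔ rk d') _ le) in
  ◇○ C a b c Δ d d' e , ⊔-raiseʳ (rk d ⊔ rk d') _ le q
raise-rank (cut C ξ d d') n le =
  let (e , q) = raise-rank d' n (m⊔n≤o⇒n≤o (suc (w ξ) ⊔ rk d) _ le) in
  cut C ξ d e , ⊔-raiseʳ (suc (w ξ) ⊔ rk d) _ le q
raise-rank (exch p d)    n le = let (e , q) = raise-rank d n le in exch p e , q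

module Reindex (φ η : Fm) where
  infix 4 _↝_ _↝ᵢ_ _↝ᶜ_

  mutual
    data _↝_ : Seq → Seq → Set where
      []  : [] ↝ []
      _∷_ : ∀ {x y xs ys} → x ↝ᵢ y → xs ↝ ys → x ∷ xs ↝ y ∷ ys

    data _↝ᵢ_ : Item → Item → Set where
      input  : ∀ {a} → ● a ↝ᵢ ● a
      output : ∀ {a} → ○ a ↝ᵢ ○ a
      nest   : ∀ {a S T} → S ↝ T → [ a ∶ S ] ↝ᵢ [ a ∶ T ]
      nest-φ : ∀ {S T} → S ↝ T → [ φ ∶ S ] ↝ᵢ [ η ∶ T ]

  data _↝ᶜ_ : Ctx → Ctx → Set where
    hole    : hole ↝ᶜ hole
    _,,_    : ∀ {Δ Δ' C C'} → Δ ↝ Δ' → C ↝ᶜ C' → Δ ,, C ↝ᶜ Δ' ,, C'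
    nestC   : ∀ {a C C'} → C ↝ᶜ C' → nestC a C ↝ᶜ nestC a C'
    nestC-φ : ∀ {C C'} → C ↝ᶜ C' → nestC φ C ↝ᶜ nestC η C'

  ↝-refl : ∀ S → S ↝ S
  ↝-refl []              = []
  ↝-refl (● a ∷ S)       = input ∷ ↝-refl S
  ↝-refl (○ a ∷ S)       = output ∷ ↝-refl S
  ↝-refl ([ a ∶ T ] ∷ S) = nest (↝-refl T) ∷ ↝-refl S

  ↝ᶜ-refl : ∀ C → C ↝ᶜ C
  ↝ᶜ-refl hole        = hole
  ↝ᶜ-refl (Δ ,, C)    = ↝-refl Δ ,, ↝ᶜ-refl C
  ↝ᶜ-refl (nestC a C) = nestC (↝ᶜ-refl C)

  ↝-++ : ∀ {A A' B B'} → A ↝ A' → B ↝ B' → A ++ B ↝ A' ++ B'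
  ↝-++ []       B↝ = B↝
  ↝-++ (x ∷ A↝) B↝ = x ∷ ↝-++ A↝ B↝

  ↝-delOut : ∀ {S T} → S ↝ T → delOut S ↝ delOut T
  ↝-delOut []              = []
  ↝-delOut (input ∷ r)     = input ∷ ↝-delOut r
  ↝-delOut (output ∷ r)    = ↝-delOut r
  ↝-delOut (nest x ∷ r)    = nest (↝-delOut x) ∷ ↝-delOut r
  ↝-delOut (nest-φ x ∷ r)  = nest-φ (↝-delOut x) ∷ ↝-delOut r

  ↝-outs : ∀ {S T} → S ↝ T → outs S ≡ outs T
  ↝-outs []              = refl
  ↝-outs (input ∷ r)     = ↝-outs r
  ↝-outs (output ∷ r)    = cong suc (↝-outs r)
  ↝-outs (nest x ∷ r)    = cong₂ _+_ (↝-outs x) (↝-outs r)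
  ↝-outs (nest-φ x ∷ r)  = cong₂ _+_ (↝-outs x) (↝-outs r)

  ↝ᶜ-↓ : ∀ {C C'} → C ↝ᶜ C' → C ↓ ↝ᶜ C' ↓
  ↝ᶜ-↓ hole        = hole
  ↝ᶜ-↓ (Δ↝ ,, C↝)  = ↝-delOut Δ↝ ,, ↝ᶜ-↓ C↝
  ↝ᶜ-↓ (nestC C↝)   = nestC (↝ᶜ-↓ C↝)
  ↝ᶜ-↓ (nestC-φ C↝) = nestC-φ (↝ᶜ-↓ C↝)

  ↝-fill : ∀ {C C' X X'} → C ↝ᶜ C' → X ↝ X' → C ⟨ X ⟩ ↝ C' ⟨ X' ⟩
  ↝-fill hole         X↝ = X↝
  ↝-fill (Δ↝ ,, C↝)   X↝ = ↝-++ Δ↝ (↝-fill C↝ X↝)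
  ↝-fill (nestC C↝)   X↝ = nest (↝-fill C↝ X↝) ∷ []
  ↝-fill (nestC-φ C↝) X↝ = nest-φ (↝-fill C↝ X↝) ∷ []

  record Split (A B T : Seq) : Set where
    constructor split
    field
      A' B' : Seq
      eq    : A' ++ B' ≡ T
      A↝    : A ↝ A'
      B↝    : B ↝ B'

  ↝-++⁻ : ∀ A {B T} → A ++ B ↝ T → Split A B T
  ↝-++⁻ []      r = split [] _ refl [] r
  ↝-++⁻ (x ∷ A) (x↝ ∷ r) with ↝-++⁻ A r
  ... | split A' B' refl A↝ B↝ = split (_ ∷ A') B' refl (x↝ ∷ A↝) B↝

  record Unfill (C : Ctx) (X T : Seq) : Set where
    constructor unfill
    field
      C'  : Ctx
      X'  : Seq
      eq  : C' ⟨ X' ⟩ ≡ T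
      C↝  : C ↝ᶜ C'
      X↝  : X ↝ X'

  ↝-fill⁻ : ∀ C {X T} → C ⟨ X ⟩ ↝ T → Unfill C X T
  ↝-fill⁻ hole r = unfill hole _ refl hole r
  ↝-fill⁻ (Δ ,, C) r with ↝-++⁻ Δ r
  ... | split Δ' _ refl Δ↝ r' with ↝-fill⁻ C r'
  ...   | unfill C' X' refl C↝ X↝ = unfill (Δ' ,, C') X' refl (Δ↝ ,, C↝) X↝
  ↝-fill⁻ (nestC a C) (nest r ∷ []) with ↝-fill⁻ C r
  ... | unfill C' X' refl C↝ X↝ = unfill (nestC a C') X' refl (nestC C↝) X↝
  ↝-fill⁻ (nestC a C) (nest-φ r ∷ []) with ↝-fill⁻ C r
  ... | unfill C' X' refl C↝ X↝ = unfill (nestC η C') X' refl (nestC-φ C↝) X↝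

  mutual
    ≈ᵢ-↝ᵢ-commute : ∀ {x y y'} → x ≈ᵢ y → y ↝ᵢ y' → Σ Item (λ x' → x ↝ᵢ x' × x' ≈ᵢ y')
    ≈ᵢ-↝ᵢ-commute ≈●      input      = _ , input , ≈●
    ≈ᵢ-↝ᵢ-commute ≈○      output     = _ , output , ≈○
    ≈ᵢ-↝ᵢ-commute (≈[] p) (nest r)   = let (_ , r' , p') = ~-↝-commute p r in _ , nest r' , ≈[] p'
    ≈ᵢ-↝ᵢ-commute (≈[] p) (nest-φ r) = let (_ , r' , p') = ~-↝-commute p r in _ , nest-φ r' , ≈[] p'

    ~-↝-commute : ∀ {S S' T} → S ~ S' → S' ↝ T → Σ Seq (λ S'' → S ↝ S'' × S'' ~ T)
    ~-↝-commute ~nil [] = [] , [] , ~nil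
    ~-↝-commute (~cons x≈ p) (x↝ ∷ r) =
      let (_ , x↝' , x≈') = ≈ᵢ-↝ᵢ-commute x≈ x↝
          (_ , r' , p')   = ~-↝-commute p r
      in _ , x↝' ∷ r' , ~cons x≈' p'
    ~-↝-commute ~swap (y↝ ∷ x↝ ∷ r) = _ , x↝ ∷ y↝ ∷ r , ~swap
    ~-↝-commute (~trans p q) r =
      let (_ , r₁ , q') = ~-↝-commute q r
          (_ , r₂ , p') = ~-↝-commute p r₁
      in _ , r₂ , ~trans p' q'

module Simulation (φ η : Fm) (D¹ : Der (● φ ∷ ○ η ∷ [])) (D² : Der (● η ∷ ○ φ ∷ []))
                  (K : ℕ) (D¹≤K : rk D¹ ≤ K) (D²≤K : rk D² ≤ K) (φ<K : suc (w φ) ≤ K) where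
  open Reindex φ η

  private
    ≤-⊔K : ∀ {x} y → x ≤ K → x ≤ y ⊔ K
    ≤-⊔K y x≤K = ≤-trans x≤K (m≤n⊔m y K)

  cut-D¹ : ∀ {a} (d : Der (● a ∷ ○ φ ∷ [])) → Σ (Der (● a ∷ ○ η ∷ [])) (λ e → rk e ≤ rk d ⊔ K)
  cut-D¹ d = let (e , rk-e) = cut-trans d D¹ in
    e , ≤-trans (≤-reflexive rk-e)
                (⊔-lub (⊔-lub (≤-⊔K (rk d) φ<K) (m≤m⊔n (rk d) K)) (≤-⊔K (rk d) D¹≤K))

  cut-D² : ∀ {a} (d : Der (● φ ∷ ○ a ∷ [])) → Σ (Der (● η ∷ ○ a ∷ [])) (λ e → rk e ≤ rk d ⊔ K)
  cut-D² d = let (e , rk-e) = cut-trans D² d in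
    e , ≤-trans (≤-reflexive rk-e)
                (⊔-lub (⊔-lub (≤-⊔K (rk d) φ<K) (≤-⊔K (rk d) D²≤K)) (m≤m⊔n (rk d) K))

  reindex : ∀ {S} (d : Der S) {T} → S ↝ T → Σ (Der T) (λ e → rk e ≤ rk d ⊔ K)
  reindex (init C p o) r with ↝-fill⁻ C r
  ... | unfill C' _ refl C↝ X↝@(input ∷ output ∷ []) =
    init C' p (trans (sym (↝-outs (↝-fill C↝ X↝))) o) , z≤n
  reindex (⊥● C o) r with ↝-fill⁻ C r
  ... | unfill C' _ refl C↝ X↝@(input ∷ []) =
    ⊥● C' (trans (sym (↝-outs (↝-fill C↝ X↝))) o) , z≤n
  reindex (∧● C a b d) r with ↝-fill⁻ C r
  ... | unfill C' _ refl C↝ (input ∷ []) =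
    let (e , h) = reindex d (↝-fill C↝ (input ∷ input ∷ [])) in ∧● C' a b e , h
  reindex (∧○ C a b d d') r with ↝-fill⁻ C r
  ... | unfill C' _ refl C↝ (output ∷ []) =
    let (e , h)   = reindex d (↝-fill C↝ (output ∷ []))
        (e' , h') = reindex d' (↝-fill C↝ (output ∷ []))
    in ∧○ C' a b e e' , ⊔-bound (rk d) (rk d') K h h'
  reindex (∨● C a b d d') r with ↝-fill⁻ C r
  ... | unfill C' _ refl C↝ (input ∷ []) =
    let (e , h)   = reindex d (↝-fill C↝ (input ∷ []))
        (e' , h') = reindex d' (↝-fill C↝ (input ∷ []))
    in ∨● C' a b e e' , ⊔-bound (rk d) (rk d') K h h'
  reindex (∨○₁ C a b d) r with ↝-fill⁻ C r
  ... | unfill C' _ refl C↝ (output ∷ []) =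
    let (e , h) = reindex d (↝-fill C↝ (output ∷ [])) in ∨○₁ C' a b e , h
  reindex (∨○₂ C a b d) r with ↝-fill⁻ C r
  ... | unfill C' _ refl C↝ (output ∷ []) =
    let (e , h) = reindex d (↝-fill C↝ (output ∷ [])) in ∨○₂ C' a b e , h
  reindex (⇒● C a b d d') r with ↝-fill⁻ C r
  ... | unfill C' _ refl C↝ (input ∷ []) =
    let (e , h)   = reindex d (↝-fill (↝ᶜ-↓ C↝) (input ∷ output ∷ []))
        (e' , h') = reindex d' (↝-fill C↝ (input ∷ []))
    in ⇒● C' a b e e' , ⊔-bound (rk d) (rk d') K h h'
  reindex (⇒○ C a b d) r with ↝-fill⁻ C r
  ... | unfill C' _ refl C↝ (output ∷ []) =
    let (e , h) = reindex d (↝-fill C↝ (input ∷ output ∷ [])) in ⇒○ C' a b e , h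
  reindex (□● C a b c Δ d d' d'') r with ↝-fill⁻ C r
  ... | unfill C' _ refl C↝ (input ∷ nest Δ↝ ∷ []) =
    let (e , h) = reindex d'' (↝-fill C↝ (input ∷ nest (input ∷ Δ↝) ∷ []))
    in □● C' a b c _ d d' e ,
       ⊔-bound (rk d ⊔ rk d') (rk d'') K
               (⊔-bound (rk d) (rk d') K (m≤m⊔n (rk d) K) (m≤m⊔n (rk d') K)) h
  ... | unfill C' _ refl C↝ (input ∷ nest-φ Δ↝ ∷ []) =
    let (e , h)   = reindex d'' (↝-fill C↝ (input ∷ nest-φ (input ∷ Δ↝) ∷ []))
        (e₁ , h₁) = cut-D¹ d
        (e₂ , h₂) = cut-D² d'
    in □● C' a b η _ e₁ e₂ e ,
       ⊔-bound (rk d ⊔ rk d') (rk d'') K (⊔-bound (rk d) (rk d') K h₁ h₂) h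
  reindex (□○ C a b d) r with ↝-fill⁻ C r
  ... | unfill C' _ refl C↝ (output ∷ []) =
    let (e , h) = reindex d (↝-fill C↝ (nest (output ∷ []) ∷ [])) in □○ C' a b e , h
  reindex (◇● C a b d) r with ↝-fill⁻ C r
  ... | unfill C' _ refl C↝ (input ∷ []) =
    let (e , h) = reindex d (↝-fill C↝ (nest (input ∷ []) ∷ [])) in ◇● C' a b e , h
  reindex (◇○ C a b c Δ d d' d'') r with ↝-fill⁻ C r
  ... | unfill C' _ refl C↝ (output ∷ nest Δ↝ ∷ []) =
    let (e , h) = reindex d'' (↝-fill C↝ (nest (output ∷ Δ↝) ∷ []))
    in ◇○ C' a b c _ d d' e ,
       ⊔-bound (rk d ⊔ rk d') (rk d'') K
               (⊔-bound (rk d) (rk d') K (m≤m⊔n (rk d) K) (m≤m⊔n (rk d') K)) h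
  ... | unfill C' _ refl C↝ (output ∷ nest-φ Δ↝ ∷ []) =
    let (e , h)   = reindex d'' (↝-fill C↝ (nest-φ (output ∷ Δ↝) ∷ []))
        (e₁ , h₁) = cut-D¹ d
        (e₂ , h₂) = cut-D² d'
    in ◇○ C' a b η _ e₁ e₂ e ,
       ⊔-bound (rk d ⊔ rk d') (rk d'') K (⊔-bound (rk d) (rk d') K h₁ h₂) h
  reindex (cut C ξ d d') r with ↝-fill⁻ C r
  ... | unfill C' _ refl C↝ [] =
    let (e , h)   = reindex d (↝-fill (↝ᶜ-↓ C↝) (output ∷ []))
        (e' , h') = reindex d' (↝-fill C↝ (input ∷ []))
    in cut C' ξ e e' ,
       ⊔-bound (suc (w ξ) ⊔ rk d) (rk d') K
               (⊔-bound (suc (w ξ)) (rk d) K (m≤m⊔n (suc (w ξ)) K) h) h'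
  reindex (exch p d) r with ~-↝-commute p r
  ... | _ , r' , p' = let (e , h) = reindex d r' in exch p' e , h

lemma2 : (φ η : Fm) (Γ : Ctx) (Δ : Seq)
         (D¹ : Der (● φ ∷ ○ η ∷ [])) (D² : Der (● η ∷ ○ φ ∷ []))
         (D³ : Der (Γ ⟨ [ φ ∶ Δ ] ∷ [] ⟩)) →
         Σ (Der (Γ ⟨ [ η ∶ Δ ] ∷ [] ⟩))
           (λ D → rk D ≡ rk D¹ ⊔ rk D² ⊔ rk D³ ⊔ suc (w φ))
lemma2 φ η Γ Δ D¹ D² D³ =
  let (D , rk-D) = reindex D³ (↝-fill (↝ᶜ-refl Γ) (nest-φ (↝-refl Δ) ∷ []))
  in raise-rank D m {{>-nonZero (≤-trans (s≤s z≤n) φ<m)}}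
                (≤-trans rk-D (≤-reflexive (m≤n⇒m⊔n≡n D³≤m)))
  where
  m = rk D¹ ⊔ rk D² ⊔ rk D³ ⊔ suc (w φ)
  D¹⊔D²≤m : rk D¹ ⊔ rk D² ≤ m
  D¹⊔D²≤m = ≤-trans (m≤m⊔n _ (rk D³)) (m≤m⊔n _ (suc (w φ)))
  D³≤m : rk D³ ≤ m
  D³≤m = ≤-trans (m≤n⊔m (rk D¹ ⊔ rk D²) _) (m≤m⊔n _ (suc (w φ)))
  φ<m : suc (w φ) ≤ m
  φ<m = m≤n⊔m (rk D¹ ⊔ rk D² ⊔ rk D³) _
  open Reindex φ η
  open Simulation φ η D¹ D² m (m⊔n≤o⇒m≤o (rk D¹) (rk D²) D¹⊔D²≤m)
                    (m⊔n≤o⇒n≤o (rk D¹) (rk D²) D¹⊔D²≤m) φ<m
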